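{- Let $x:\mathbb{N}\to\mathbb{R}_D$ be a sequence equipped with a modulus of Cauchy convergence $M:\mathbb{Q}_+\to\mathbb{N}$, i.e. for all $\varepsilon:\mathbb{Q}_+$ and $m,n\geq M(\varepsilon)$ we have $|x_m-x_n|<\varepsilon$, and suppose we are given an element of $\prod_{n:\mathbb{N}}\operatorname{locator}(x_n)$. Then the limit $\lim_{n\to\infty}x_n:\mathbb{R}_D$ has a locator.
   Context: Work in Martin-Löf type theory with propositional truncation, function extensionality and propositional extensionality. A Dedekind real is a pair $x=(L,U)$ of proposition-valued predicates on $\mathbb{Q}$, writing $q<x$ for $q\in L$ and $x<r$ for $r\in U$, which is bounded, rounded, transitive and located ($q<r\Rightarrow\|(q<x)+(x<r)\|$). $\mathbb{R}_D$ is the type of Dedekind reals with the usual field operations, order and absolute value; it is Cauchy complete, and $\lim_{n\to\infty}x_n$ denotes the unique $l:\mathbb{R}_D$ with $\forall\varepsilon:\mathbb{Q}_+\,\exists N\,\forall n\ge N.\,|x_n-l|<\varepsilon$. $\mathbb{Q}_+$ is the type of positive rationals. A locator for $x$ is a function $\prod_{q,r:\mathbb{Q}}(q<r)\to(q<x)+(x<r)$ into the untruncated disjoint sum; $\operatorname{locator}(x)$ is the type of locators of $x$. -}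

module Defs where

open import Level using (Level; suc; zero)
open import Data.Nat using (ℕ; _≥_)
open import Data.Rational using (ℚ; Positive; _+_; -_) renaming (_<_ to _<ℚ_)
open import Data.Product using (Σ; _×_; _,_; proj₁)
open import Data.Sum using (_⊎_)
open import Relation.Binary.PropositionalEquality using (_≡_)

isProp : Set → Set
isProp A = (a b : A) → a ≡ b

-- Propositional truncation, via its (impredicative) universal property:
-- ∥ A ∥ eliminates into every proposition of Set.  Lives in Set₁.
∥_∥ : Set → Set₁
∥ A ∥ = {P : Set} → isProp P → (A → P) → P

∃∥ : (A : Set) → (A → Set) → Set₁
∃∥ A B = ∥ Σ A B ∥

ℚ₊ : Set
ℚ₊ = Σ ℚ Positive

-- Dedekind reals: a pair (L , U) of proposition-valued predicates on ℚ
-- which is bounded, rounded, transitive and located.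
-- q ∈ L  reads  q < x ;   r ∈ U  reads  x < r.
record ℝD : Set₁ where
  field
    L U       : ℚ → Set
    L-prop    : ∀ q → isProp (L q)
    U-prop    : ∀ r → isProp (U r)
    bounded-L : ∃∥ ℚ L
    bounded-U : ∃∥ ℚ U
    rounded-L : ∀ q → (L q → ∃∥ ℚ (λ q' → (q <ℚ q') × L q'))
                    × (∃∥ ℚ (λ q' → (q <ℚ q') × L q') → L q)
    rounded-U : ∀ r → (U r → ∃∥ ℚ (λ r' → (r' <ℚ r) × U r'))
                    × (∃∥ ℚ (λ r' → (r' <ℚ r) × U r') → U r)
    transitive : ∀ q r → L q → U r → q <ℚ r
    located   : ∀ q r → q <ℚ r → ∥ L q ⊎ U r ∥

open ℝD public

_<ᵣ_ : ℚ → ℝD → Set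
q <ᵣ x = L x q

_ᵣ<_ : ℝD → ℚ → Set
x ᵣ< r = U x r

-- Upper cut of the real  a − b  =  a + (−b):
--   a − b < s  iff  ∃ u v. a < u ∧ (−b) < v ∧ s = u + v,
-- and  (−b) < v  iff  −v < b   (standard Dedekind operations, unfolded).
SubLt : ℝD → ℝD → ℚ → Set₁
SubLt a b s = ∃∥ ℚ (λ u → Σ ℚ (λ v → (a ᵣ< u) × ((- v) <ᵣ b) × (s ≡ u + v)))

-- |a − b| = max(a − b, b − a); the upper cut of a max is the intersection
-- of the upper cuts.  So  |a − b| < ε  iff  a − b < ε  and  b − a < ε.
AbsSubLt : ℝD → ℝD → ℚ → Set₁
AbsSubLt a b ε = SubLt a b ε × SubLt b a ε

IsCauchyModulus : (ℕ → ℝD) → (ℚ₊ → ℕ) → Set₁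
IsCauchyModulus x M = (ε : ℚ₊) (m n : ℕ) → m ≥ M ε → n ≥ M ε →
  AbsSubLt (x m) (x n) (proj₁ ε)

IsLimit : (ℕ → ℝD) → ℝD → Set₂
IsLimit x l = (ε : ℚ₊) → ∥ Σ ℕ (λ N → (n : ℕ) → n ≥ N → AbsSubLt (x n) l (proj₁ ε)) ∥₁
  where
  ∥_∥₁ : Set₁ → Set₂
  ∥ A ∥₁ = {P : Set₁} → ((a b : P) → a ≡ b) → (A → P) → P

Locator : ℝD → Set
Locator x = (q r : ℚ) → q <ℚ r → (q <ᵣ x) ⊎ (x ᵣ< r)

module Submission where

-- A real that is approximated arbitrarily well by located reals is itself
-- located; the limit of a Cauchy sequence of located reals is such a real.
--
-- The central notion is  ApproxWithin y l e : "y approximates l within e",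
-- stated directly on the cuts:  c + e < y  implies  c < l,  and  y < c − e
-- implies  l < c.  Because its conclusions are propositions, it can be
-- extracted from a truncated hypothesis.

open import Defs
open import Level using (Lift; lift; lower)
open import Data.Nat using (ℕ; _⊔_)
open import Data.Nat.Properties using (≤-refl; m≤m⊔n; m≤n⊔m)
open import Data.Rational
  using (ℚ; ½; _*_; _+_; -_; 0ℚ; Positive; positive)
  renaming (_<_ to _<ℚ_)
open import Data.Rational.Properties
  using (+-assoc; +-comm; neg-distrib-+; +-monoˡ-<; +-monoʳ-<; <-respˡ-≡; <-respʳ-≡; pos*pos⇒pos; positive⁻¹; +-identityʳ)
open import Data.Rational.Solver using (module +-*-Solver)
open +-*-Solver
open import Data.Product using (Σ; _×_; _,_; proj₁; proj₂)
open import Data.Sum using (_⊎_; inj₁; inj₂; [_,_]′)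
open import Relation.Binary.PropositionalEquality using (_≡_; refl; trans; cong; subst; module ≡-Reasoning)
open ≡-Reasoning

<-split-lower : ∀ c e u v → e ≡ u + v → c + e <ℚ u → c <ℚ - v
<-split-lower c e u v e≡u+v lt = <-respʳ-≡ u-e≡-v (<-respˡ-≡ c+e-e≡c (+-monoˡ-< (- e) lt))
  where
  c+e-e≡c : (c + e) + - e ≡ c
  c+e-e≡c = solve 2 (λ c e → (c :+ e) :+ :- e := c) refl c e
  u-e≡-v : u + - e ≡ - v
  u-e≡-v = trans (cong (λ z → u + - z) e≡u+v) (solve 2 (λ u v → u :+ :- (u :+ v) := :- v) refl u v)

<-split-upper : ∀ c e u v → e ≡ u + v → - v <ℚ c + - e → u <ℚ c
<-split-upper c e u v e≡u+v lt = <-respʳ-≡ c-e+e≡c (<-respˡ-≡ -v+e≡u (+-monoˡ-< e lt))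
  where
  c-e+e≡c : (c + - e) + e ≡ c
  c-e+e≡c = solve 2 (λ c e → (c :+ :- e) :+ e := c) refl c e
  -v+e≡u : - v + e ≡ u
  -v+e≡u = trans (cong (λ z → - v + z) e≡u+v) (solve 2 (λ u v → :- v :+ (u :+ v) := u) refl u v)

lower-closed : (x : ℝD) {q q' : ℚ} → q <ℚ q' → q' <ᵣ x → q <ᵣ x
lower-closed x {q} {q'} q<q' q'<x = proj₂ (rounded-L x q) (λ _ k → k (q' , q<q' , q'<x))

upper-closed : (x : ℝD) {r r' : ℚ} → r' <ℚ r → x ᵣ< r' → x ᵣ< r
upper-closed x {r} {r'} r'<r x<r' = proj₂ (rounded-U x r) (λ _ k → k (r' , r'<r , x<r'))

ApproxWithin : ℝD → ℝD → ℚ → Set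
ApproxWithin y l e = (∀ c → (c + e) <ᵣ y → c <ᵣ l) × (∀ c → y ᵣ< (c + - e) → l ᵣ< c)

subLt⇒lower : ∀ a b e c → SubLt a b e → (c + e) <ᵣ a → c <ᵣ b
subLt⇒lower a b e c a-b<e c+e<a = a-b<e (L-prop b c) λ where
  (u , v , a<u , -v<b , e≡u+v) →
    lower-closed b (<-split-lower c e u v e≡u+v (transitive a (c + e) u c+e<a a<u)) -v<b

subLt⇒upper : ∀ a b e c → SubLt b a e → a ᵣ< (c + - e) → b ᵣ< c
subLt⇒upper a b e c b-a<e a<c-e = b-a<e (U-prop b c) λ where
  (u , v , b<u , -v<a , e≡u+v) →
    upper-closed b (<-split-upper c e u v e≡u+v (transitive a (- v) (c + - e) -v<a a<c-e)) b<u

absSubLt⇒approx : ∀ a b e → AbsSubLt a b e → ApproxWithin a b e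
absSubLt⇒approx a b e (a-b<e , b-a<e) =
  (λ c → subLt⇒lower a b e c a-b<e) , (λ c → subLt⇒upper a b e c b-a<e)

approx-trans : ∀ a b c e e' → ApproxWithin a b e → ApproxWithin b c e' → ApproxWithin a c (e + e')
approx-trans a b c e e' (a-lo , a-hi) (b-lo , b-hi) =
  (λ t t+E<a → b-lo t (a-lo (t + e') (subst (_<ᵣ a) (reassoc-lower t) t+E<a)))
  , (λ t a<t-E → b-hi t (a-hi (t + - e') (subst (a ᵣ<_) (reassoc-upper t) a<t-E)))
  where
  reassoc-lower : ∀ t → t + (e + e') ≡ (t + e') + e
  reassoc-lower t = begin
    t + (e + e')  ≡⟨ cong (t +_) (+-comm e e') ⟩
    t + (e' + e)  ≡⟨ +-assoc t e' e ⟨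
    (t + e') + e  ∎
  reassoc-upper : ∀ t → t + - (e + e') ≡ (t + - e') + - e
  reassoc-upper t = begin
    t + - (e + e')     ≡⟨ cong (λ s → t + - s) (+-comm e e') ⟩
    t + - (e' + e)     ≡⟨ cong (t +_) (neg-distrib-+ e' e) ⟩
    t + (- e' + - e)   ≡⟨ +-assoc t (- e') (- e) ⟨
    (t + - e') + - e   ∎

-- Truncation at level 1, matching the one used by IsLimit.
Trunc₁ : Set₁ → Set₂
Trunc₁ A = {P : Set₁} → ((a b : P) → a ≡ b) → (A → P) → P

lift-isProp : {A : Set} → isProp A → (a b : Lift (Level.suc Level.zero) A) → a ≡ b
lift-isProp A-prop (lift a) (lift b) = cong lift (A-prop a b)

-- Approximation only concludes propositions, so it survives truncation.
untruncate-approx : ∀ {A : Set₁} y l e → Trunc₁ A → (A → ApproxWithin y l e) → ApproxWithin y l e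
untruncate-approx y l e ∥A∥ approx =
  (λ c c+e<y → lower (∥A∥ (lift-isProp (L-prop l c)) λ a → lift (proj₁ (approx a) c c+e<y)))
  , (λ c y<c-e → lower (∥A∥ (lift-isProp (U-prop l c)) λ a → lift (proj₂ (approx a) c y<c-e)))

-- The term x (M δ) approximates the limit within 2δ: it is δ-close to all
-- later terms, and some later term is δ-close to the limit.
tail-approximates-limit : (x : ℕ → ℝD) (M : ℚ₊ → ℕ) (l : ℝD) →
  IsCauchyModulus x M → IsLimit x l → (δ : ℚ₊) →
  ApproxWithin (x (M δ)) l (proj₁ δ + proj₁ δ)
tail-approximates-limit x M l cauchy limit δ =
  untruncate-approx (x N) l (e + e) (limit δ) λ where
    (N' , tail-close) →
      let n = N ⊔ N'
      in approx-trans (x N) (x n) l e e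
           (absSubLt⇒approx (x N) (x n) e (cauchy δ N n ≤-refl (m≤m⊔n N N')))
           (absSubLt⇒approx (x n) l e (tail-close n (m≤n⊔m N N')))
  where
  e : ℚ
  e = proj₁ δ
  N : ℕ
  N = M δ

module QuarterGap (q r : ℚ) (q<r : q <ℚ r) where
  gap : ℚ
  gap = r + - q

  instance
    gap-pos : Positive gap
    gap-pos = positive (<-respˡ-≡ (solve 1 (λ q → q :+ :- q := con 0ℚ) refl q) (+-monoˡ-< (- q) q<r))
    half-gap-pos : Positive (gap * ½)
    half-gap-pos = pos*pos⇒pos gap ½

  ε₊ : ℚ₊
  ε₊ = gap * ½ * ½ , pos*pos⇒pos (gap * ½) ½

  ε : ℚ
  ε = proj₁ ε₊

  inner-ordered : q + ε <ℚ r + - ε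
  inner-ordered = <-respˡ-≡ (+-identityʳ (q + ε)) (<-respʳ-≡ widen (+-monoʳ-< (q + ε) (positive⁻¹ (gap * ½))))
    where
    widen : (q + ε) + gap * ½ ≡ r + - ε
    widen = solve 2 (λ q r → (q :+ (r :+ :- q) :* con ½ :* con ½) :+ (r :+ :- q) :* con ½
                           := r :+ :- ((r :+ :- q) :* con ½ :* con ½)) refl q r

approximable⇒locator : (l : ℝD) →
  ((ε : ℚ₊) → Σ ℝD (λ y → Locator y × ApproxWithin y l (proj₁ ε))) →
  Locator l
approximable⇒locator l approximations q r q<r = decide (approximations ε₊)
  where
  open QuarterGap q r q<r
  decide : Σ ℝD (λ y → Locator y × ApproxWithin y l ε) → (q <ᵣ l) ⊎ (l ᵣ< r)
  decide (y , locate-y , y-lo , y-hi) =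
    [ (λ q+ε<y → inj₁ (y-lo q q+ε<y)) , (λ y<r-ε → inj₂ (y-hi r y<r-ε)) ]′
      (locate-y (q + ε) (r + - ε) inner-ordered)

halve : ℚ₊ → ℚ₊
halve (e , e-pos) = e * ½ , pos*pos⇒pos e {{e-pos}} ½

halve+halve : (ε : ℚ₊) → proj₁ (halve ε) + proj₁ (halve ε) ≡ proj₁ ε
halve+halve (e , _) = solve 1 (λ e → e :* con ½ :+ e :* con ½ := e) refl e

lemma3p28 : (x : ℕ → ℝD) (M : ℚ₊ → ℕ) → IsCauchyModulus x M →
    ((n : ℕ) → Locator (x n)) →
    (l : ℝD) → IsLimit x l → Locator l
lemma3p28 x M cauchy locate l limit = approximable⇒locator l approximation
  where
  approximation : (ε : ℚ₊) → Σ ℝD (λ y → Locator y × ApproxWithin y l (proj₁ ε))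
  approximation ε =
    x (M (halve ε)) , locate (M (halve ε))
    , subst (ApproxWithin (x (M (halve ε))) l) (halve+halve ε)
        (tail-approximates-limit x M l cauchy limit (halve ε))
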